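{- If $\Gamma_1,\Gamma_2\Rightarrow\Delta$ is a minimal Herbrand sequent of $\Psi\Rightarrow C_k$, then $|\Gamma_1|\ge 2^1_k$.
   Context: Consider the first-order language (without equality) with a constant $0$, a unary function symbol $S$ and a ternary relation symbol $R$; $\bar n$ abbreviates $S^n(0)$. Let $\mathrm{Hyp}_1\equiv\forall x\,R(x,0,S(x))$, $\mathrm{Hyp}_2\equiv\forall y\forall x\forall z\forall z_1(R(y,x,z)\land R(z,x,z_1)\to R(y,S(x),z_1))$, $\Psi=\{\mathrm{Hyp}_1,\mathrm{Hyp}_2\}$, and $C_k\equiv\exists z_k\ldots\exists z_0(R(0,0,z_k)\land R(0,z_k,z_{k-1})\land\dots\land R(0,z_1,z_0))$. A sequent $\Gamma\Rightarrow\Delta$ is valid if $\bigwedge\Gamma\to\bigvee\Delta$ is logically valid. A Herbrand sequent of $\Psi\Rightarrow C_k$ is a valid sequent $\Gamma_1,\Gamma_2\Rightarrow\Delta$ where $\Gamma_1$ is a finite set of substitution instances $R(u,0,S(u))$ of the matrix of $\mathrm{Hyp}_1$, $\Gamma_2$ a finite set of substitution instances $R(u,v,w)\land R(w,v,w')\to R(u,S(v),w')$ of the matrix of $\mathrm{Hyp}_2$, and $\Delta$ a finite set of substitution instances of the matrix $R(0,0,z_k)\land R(0,z_k,z_{k-1})\land\dots\land R(0,z_1,z_0)$ of $C_k$ (by arbitrary terms). It is minimal if no sequent obtained from it by deleting at least one formula is a Herbrand sequent of $\Psi\Rightarrow C_k$. Hyperexponential: $2^x_0=x$, $2^x_{i+1}=2^{2^x_i}$.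 -}

module Defs where

open import Data.Nat using (ℕ; zero; suc; _+_; _^_; _<_)
open import Data.Bool using (Bool; true; false; _∧_; _∨_; not)
open import Data.List using (List; []; _∷_; _++_; length)
open import Data.List.Relation.Unary.All using (All)
open import Data.List.Relation.Unary.Any using (Any)
open import Data.List.Relation.Binary.Sublist.Propositional using (_⊆_)
open import Data.Vec using (Vec; []; _∷_)
open import Data.Product using (Σ; ∃; _×_; _,_)
open import Relation.Binary.PropositionalEquality using (_≡_)
open import Relation.Nullary using (¬_)

data Term : Set where
  var  : ℕ → Term
  zer  : Term
  S    : Term → Term

-- Quantifier-free formulas (all matrices involved are quantifier-free).
data Fm : Set where
  R    : Term → Term → Term → Fm
  _∧̇_  : Fm → Fm → Fm
  _⇒̇_  : Fm → Fm → Fm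

record Structure : Set₁ where
  field
    D  : Set
    z  : D
    s  : D → D
    r  : D → D → D → Bool

module _ (M : Structure) (ρ : ℕ → Structure.D M) where
  open Structure M
  evalT : Term → D
  evalT (var i) = ρ i
  evalT zer     = z
  evalT (S t)   = s (evalT t)

  evalF : Fm → Bool
  evalF (R a b c) = r (evalT a) (evalT b) (evalT c)
  evalF (φ ∧̇ ψ)   = evalF φ ∧ evalF ψ
  evalF (φ ⇒̇ ψ)   = not (evalF φ) ∨ evalF ψ

Valid : List Fm → List Fm → Set₁
Valid Γ Δ = (M : Structure) (ρ : ℕ → Structure.D M) →
  All (λ φ → evalF M ρ φ ≡ true) Γ → Any (λ φ → evalF M ρ φ ≡ true) Δ

hyp1Inst : Term → Fm
hyp1Inst u = R u zer (S u)

hyp2Inst : Term → Term → Term → Term → Fm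
hyp2Inst u v w w' = (R u v w ∧̇ R w v w') ⇒̇ R u (S v) w'

-- Matrix of C_k instantiated with (z_k , z_{k-1} , … , z_0) := ts :
--   R(0,0,z_k) ∧ R(0,z_k,z_{k-1}) ∧ … ∧ R(0,z_1,z_0)
chain : ∀ {n} → Term → Term → Vec Term n → Fm
chain prev t []        = R zer prev t
chain prev t (t' ∷ ts) = R zer prev t ∧̇ chain t t' ts

cInst : (k : ℕ) → Vec Term (suc k) → Fm
cInst k (t ∷ ts) = chain zer t ts

IsHyp1Inst : Fm → Set
IsHyp1Inst φ = Σ Term λ u → φ ≡ hyp1Inst u

IsHyp2Inst : Fm → Set
IsHyp2Inst φ = Σ Term λ u → Σ Term λ v → Σ Term λ w → Σ Term λ w' →
  φ ≡ hyp2Inst u v w w'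

IsCInst : ℕ → Fm → Set
IsCInst k φ = Σ (Vec Term (suc k)) λ ts → φ ≡ cInst k ts

-- Herbrand sequent Γ₁ , Γ₂ ⇒ Δ of Ψ ⇒ C_k
-- (finite sets of formulas represented by lists).
HerbrandSeq : ℕ → List Fm → List Fm → List Fm → Set₁
HerbrandSeq k Γ₁ Γ₂ Δ =
  All IsHyp1Inst Γ₁ × All IsHyp2Inst Γ₂ × All (IsCInst k) Δ ×
  Valid (Γ₁ ++ Γ₂) Δ

-- Minimal: no sequent obtained by deleting at least one formula
-- (i.e. a sub-list of each component, strictly fewer formulas in total)
-- is a Herbrand sequent of Ψ ⇒ C_k.
MinimalHerbrandSeq : ℕ → List Fm → List Fm → List Fm → Set₁
MinimalHerbrandSeq k Γ₁ Γ₂ Δ =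
  HerbrandSeq k Γ₁ Γ₂ Δ ×
  ((Γ₁' Γ₂' Δ' : List Fm) → Γ₁' ⊆ Γ₁ → Γ₂' ⊆ Γ₂ → Δ' ⊆ Δ →
    length Γ₁' + length Γ₂' + length Δ' < length Γ₁ + length Γ₂ + length Δ →
    ¬ HerbrandSeq k Γ₁' Γ₂' Δ')

hyp2 : ℕ → ℕ → ℕ
hyp2 x zero    = x
hyp2 x (suc i) = 2 ^ hyp2 x i

-- Interpret the language over ℕ, every variable denoting 0, with R(x, y, z) meaning
-- "z = x + 2^y and each number in [x, x + 2^y) is the value of a term u with
-- R(u, 0, S u) in Γ₁". Then all of Γ₁ is true, and so is every instance of Hyp₂,
-- since two adjacent covered blocks of length 2^y form one of length 2^(y+1).
-- By validity some instance of C_k is true; its atoms force z_k = 2^0 and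
-- z_(i-1) = 2^(z_i), so the last atom R(0, z_1, z_0) covers [0, 2^1_k) and Γ₁
-- needs 2^1_k different values.
module Submission where

open import Defs
open import Data.Nat using (ℕ; _≤_)
open import Data.List using (List; length)

open import Data.Bool using (true; _∧_; _∨_; not)
open import Data.Bool.Properties using (∧-conicalˡ; ∧-conicalʳ)
open import Data.Fin using (Fin; toℕ)
open import Data.Fin.Properties using (injective⇒≤; toℕ<n; toℕ-injective)
open import Data.List using (map; lookup)
open import Data.List.Properties using (length-map)
open import Data.List.Membership.Propositional using (_∈_)
open import Data.List.Membership.Propositional.Properties using (∈-map⁺)
open import Data.List.Membership.DecPropositional (Data.Nat._≟_) using (_∈?_)
open import Data.List.Relation.Unary.All as All using (All)
open import Data.List.Relation.Unary.All.Properties using (++⁺)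
open import Data.List.Relation.Unary.Any using (index)
open import Data.List.Relation.Unary.Any.Properties using (lookup-index)
open import Data.Nat using (zero; suc; s≤s; _+_; _∸_; _^_; _<_)
open import Data.Nat.Properties
  using (_≟_; _<?_; ≮⇒≥; +-assoc; +-comm; +-identityʳ; m+[n∸m]≡n; m+n∸m≡n; ∸-monoˡ-<; allUpTo?; ≤-reflexive; module ≤-Reasoning)
open import Data.Product using (_×_; _,_; proj₂)
open import Data.Vec using (Vec; []; _∷_)
open import Function using (_∘_)
open import Function.Definitions using (Injective)
open import Relation.Binary.PropositionalEquality using (_≡_; refl; sym; trans; cong; subst; module ≡-Reasoning)
open import Relation.Nullary.Decidable using (Dec; yes; no; does; _×-dec_; dec-true)

∈-injection⇒≤length : ∀ {a} {A : Set a} {n} {xs : List A} (f : Fin n → A) →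
  Injective _≡_ _≡_ f → (∀ i → f i ∈ xs) → n ≤ length xs
∈-injection⇒≤length {xs = xs} f f-injective f∈xs = injective⇒≤ position-injective
  where
  position : _ → Fin (length xs)
  position i = index (f∈xs i)

  position-injective : Injective _≡_ _≡_ position
  position-injective {i} {j} same = f-injective (begin
    f i                     ≡⟨ lookup-index (f∈xs i) ⟩
    lookup xs (position i)  ≡⟨ cong (lookup xs) same ⟩
    lookup xs (position j)  ≡⟨ lookup-index (f∈xs j) ⟨
    f j                     ∎)
    where open ≡-Reasoning

<⇒∈⇒≤length : ∀ {n} {xs : List ℕ} → (∀ {i} → i < n → i ∈ xs) → n ≤ length xs
<⇒∈⇒≤length <⇒∈ = ∈-injection⇒≤length toℕ toℕ-injective (<⇒∈ ∘ toℕ<n)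

Covers : List ℕ → ℕ → ℕ → Set
Covers U x n = ∀ {i} → i < n → x + i ∈ U

covers? : ∀ U x n → Dec (Covers U x n)
covers? U x = allUpTo? (λ i → x + i ∈? U)

covers-+ : ∀ {U x a b} → Covers U x a → Covers U (x + a) b → Covers U x (a + b)
covers-+ {U} {x} {a} {b} first second {i} i<a+b with i <? a
... | yes i<a = first i<a
... | no  i≮a = subst (_∈ U) shift (second i∸a<b)
  where
  a≤i = ≮⇒≥ i≮a

  i∸a<b : i ∸ a < b
  i∸a<b = subst (i ∸ a <_) (m+n∸m≡n a b) (∸-monoˡ-< i<a+b a≤i)

  shift : x + a + (i ∸ a) ≡ x + i
  shift = begin
    x + a + (i ∸ a)    ≡⟨ +-assoc x a (i ∸ a) ⟩
    x + (a + (i ∸ a))  ≡⟨ cong (x +_) (m+[n∸m]≡n a≤i) ⟩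
    x + i              ∎
    where open ≡-Reasoning

hyp2-2^ : ∀ x n → hyp2 (2 ^ x) n ≡ hyp2 x (suc n)
hyp2-2^ x zero    = refl
hyp2-2^ x (suc n) = cong (2 ^_) (hyp2-2^ x n)

does-true⇒ : ∀ {a} {A : Set a} (a? : Dec A) → does a? ≡ true → A
does-true⇒ (yes a) _ = a

does-→ : ∀ {a b c} {A : Set a} {B : Set b} {C : Set c} (a? : Dec A) (b? : Dec B) (c? : Dec C) →
  (A → B → C) → not (does a? ∧ does b?) ∨ does c? ≡ true
does-→ (no _)  _       _  _ = refl
does-→ (yes _) (no _)  _  _ = refl
does-→ (yes a) (yes b) c? f = dec-true c? (f a b)

value : Term → ℕ
value (var _) = 0
value zer     = 0
value (S t)   = suc (value t)

subject : Fm → Term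
subject (R u _ _) = u
subject _         = zer

module DoublingModel (U : List ℕ) where

  Doubling : ℕ → ℕ → ℕ → Set
  Doubling x y z = z ≡ x + 2 ^ y × Covers U x (2 ^ y)

  doubling? : ∀ x y z → Dec (Doubling x y z)
  doubling? x y z = (z ≟ x + 2 ^ y) ×-dec covers? U x (2 ^ y)

  doubling-step : ∀ {x y z w} → Doubling x y z → Doubling z y w → Doubling x (suc y) w
  doubling-step {x} {y} {z} {w} (refl , first) (refl , second) = sum , covered
    where
    p = 2 ^ y

    2^suc : 2 ^ suc y ≡ p + p
    2^suc = cong (p +_) (+-identityʳ p)

    sum : x + p + p ≡ x + 2 ^ suc y
    sum = begin
      x + p + p    ≡⟨ +-assoc x p p ⟩
      x + (p + p)  ≡⟨ cong (x +_) 2^suc ⟨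
      x + 2 ^ suc y ∎
      where open ≡-Reasoning

    covered : Covers U x (2 ^ suc y)
    covered = subst (Covers U x) (sym 2^suc) (covers-+ first second)

  model : Structure
  model = record { D = ℕ ; z = 0 ; s = suc ; r = λ x y z → does (doubling? x y z) }

  ρ₀ : ℕ → ℕ
  ρ₀ _ = 0

  ⟦_⟧ : Term → ℕ
  ⟦_⟧ = evalT model ρ₀

  Holds : Fm → Set
  Holds φ = evalF model ρ₀ φ ≡ true

  ⟦⟧≡value : ∀ t → ⟦ t ⟧ ≡ value t
  ⟦⟧≡value (var _) = refl
  ⟦⟧≡value zer     = refl
  ⟦⟧≡value (S t)   = cong suc (⟦⟧≡value t)

  holds-hyp1Inst : ∀ {φ} → IsHyp1Inst φ → value (subject φ) ∈ U → Holds φ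
  holds-hyp1Inst (u , refl) u∈U = dec-true (doubling? ⟦ u ⟧ 0 (suc ⟦ u ⟧)) (+-comm 1 ⟦ u ⟧ , covered)
    where
    covered : Covers U ⟦ u ⟧ 1
    covered {zero}  _              = subst (_∈ U) (sym (trans (+-identityʳ ⟦ u ⟧) (⟦⟧≡value u))) u∈U
    covered {suc _} (s≤s ())

  holds-hyp2Inst : ∀ {φ} → IsHyp2Inst φ → Holds φ
  holds-hyp2Inst (u , v , w , w′ , refl) =
    does-→ (doubling? ⟦ u ⟧ ⟦ v ⟧ ⟦ w ⟧) (doubling? ⟦ w ⟧ ⟦ v ⟧ ⟦ w′ ⟧) (doubling? ⟦ u ⟧ (suc ⟦ v ⟧) ⟦ w′ ⟧)
      (doubling-step {y = ⟦ v ⟧})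

  holds-chain⇒covers : ∀ {n} prev t (ts : Vec Term n) → Holds (chain prev t ts) →
    Covers U 0 (hyp2 ⟦ prev ⟧ (suc n))
  holds-chain⇒covers prev t [] holds = proj₂ (does-true⇒ (doubling? 0 ⟦ prev ⟧ ⟦ t ⟧) holds)
  holds-chain⇒covers {suc n} prev t (t′ ∷ ts) holds =
    subst (Covers U 0) length≡ (holds-chain⇒covers t t′ ts (∧-conicalʳ _ _ holds))
    where
    t≡2^prev : ⟦ t ⟧ ≡ 2 ^ ⟦ prev ⟧
    t≡2^prev with t≡ , _ ← does-true⇒ (doubling? 0 ⟦ prev ⟧ ⟦ t ⟧) (∧-conicalˡ _ _ holds) = t≡

    length≡ : hyp2 ⟦ t ⟧ (suc n) ≡ hyp2 ⟦ prev ⟧ (suc (suc n))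
    length≡ = begin
      hyp2 ⟦ t ⟧ (suc n)             ≡⟨ cong (λ x → hyp2 x (suc n)) t≡2^prev ⟩
      hyp2 (2 ^ ⟦ prev ⟧) (suc n)    ≡⟨ hyp2-2^ ⟦ prev ⟧ (suc n) ⟩
      hyp2 ⟦ prev ⟧ (suc (suc n))    ∎
      where open ≡-Reasoning

  holds-cInst⇒covers : ∀ {k φ} → IsCInst k φ → Holds φ → Covers U 0 (hyp2 1 k)
  holds-cInst⇒covers {k} (t ∷ ts , refl) holds =
    subst (Covers U 0) (sym (hyp2-2^ 0 k)) (holds-chain⇒covers zer t ts holds)

mainTheorem11 : (k : ℕ) (Γ₁ Γ₂ Δ : List Fm) →
    MinimalHerbrandSeq k Γ₁ Γ₂ Δ → hyp2 1 k ≤ length Γ₁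
mainTheorem11 k Γ₁ Γ₂ Δ ((hyps₁ , hyps₂ , conclusions , valid) , _) = begin
  hyp2 1 k   ≤⟨ <⇒∈⇒≤length covered ⟩
  length U   ≤⟨ ≤-reflexive (length-map (value ∘ subject) Γ₁) ⟩
  length Γ₁  ∎
  where
  open ≤-Reasoning
  U = map (value ∘ subject) Γ₁
  open DoublingModel U

  holds-Γ₁ : All Holds Γ₁
  holds-Γ₁ = All.tabulate λ φ∈Γ₁ → holds-hyp1Inst (All.lookup hyps₁ φ∈Γ₁) (∈-map⁺ (value ∘ subject) φ∈Γ₁)

  covered : Covers U 0 (hyp2 1 k)
  covered = All.lookupWith holds-cInst⇒covers conclusions
    (valid model ρ₀ (++⁺ holds-Γ₁ (All.map holds-hyp2Inst hyps₂)))
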